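{- (1) For any prime $p$, the integers whose prime decomposition has the form $p_1^{2p^2-1}$ ($p_1$ prime) are $p^2$-$T_0T^\ast$-perfect numbers. (2) If $p$ is an odd prime, then the integers whose prime decomposition has the form $p_1^{(p-1)/2}\cdot p_2^{(p-1)/2}$ ($p_1\neq p_2$ primes) are $p^2$-$T_0T^\ast$-perfect numbers. (3) For a prime $p$, any integer $n>1$ whose prime decomposition is neither of the form $p_1^{2p^2-1}$ nor (when $p$ is odd) of the form $p_1^{(p-1)/2}\cdot p_2^{(p-1)/2}$ is not a $p^2$-$T_0T^\ast$-perfect number.
   Context: $T(m)$ denotes the product of all positive divisors of $m$. A divisor $d$ of $m$ is unitary if $\gcd(d,m/d)=1$, and $T^\ast(m)$ denotes the product of all unitary divisors of $m$. For an integer $K\ge 2$, an integer $n>1$ is called $K$-$T_0T^\ast$-perfect if $T(T^\ast(n))=n^K$. -}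

module Defs where

open import Data.Nat using (ℕ; suc; _*_; _^_; _/_; _≟_)
open import Data.Nat.Divisibility using (_∣_; _∣?_)
open import Data.Nat.GCD using (gcd)
open import Data.List using (List; filter; map; upTo)
open import Data.Nat.ListAction using (product)
open import Data.Product using (_×_)
open import Relation.Nullary.Decidable using (_×-dec_)
open import Relation.Binary.PropositionalEquality using (_≡_)

divisors : ℕ → List ℕ
divisors m = map suc (filter (λ k → suc k ∣? m) (upTo m))

unitaryDivisors : ℕ → List ℕ
unitaryDivisors m =
  map suc (filter (λ k → (suc k ∣? m) ×-dec (gcd (suc k) (m / suc k) ≟ 1)) (upTo m))

T : ℕ → ℕ
T m = product (divisors m)

T* : ℕ → ℕ
T* m = product (unitaryDivisors m)

-- n is K-T₀T*-perfect (n > 1 is imposed separately where needed)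
KPerfect : ℕ → ℕ → Set
KPerfect K n = T (T* n) ≡ n ^ K

module Submission where

-- Pairing each divisor d of m with its cofactor m/d shows T(m)² = m^τ(m) and
-- T*(m)² = m^τ*(m), where τ and τ* count the divisors and the unitary divisors.
-- Both counts are multiplicative on coprime factors, and for a prime power q^e
-- with e > 0 they equal e + 1 and 2.  Hence, if τ*(n) = 2w, then T*(n) = n^w and
-- T(T*(n))² = n^(w·τ(n^w)), so n is K-perfect iff w·τ(n^w) = 2K (the perfection
-- criterion).  Splitting off one prime power, n = q^a·r with q ∤ r, gives
-- τ*(n) = 2·τ*(r) and τ(n^k) = (ak+1)·τ(r^k).  Thus one prime factor turns the
-- criterion into a + 1 = 2p², two prime factors into (2a+1)(2b+1) = p², which
-- forces 2a+1 = 2b+1 = p, and three or more into 4v(4va+1)·t = 2p², which is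
-- impossible.

open import Defs
open import Data.Nat
open import Data.Nat.Properties
open import Data.Nat.Divisibility
open import Data.Nat.DivMod
open import Data.Nat.GCD
open import Data.Nat.Coprimality using (Coprime; coprime-divisor; coprime-/gcd; coprime⇒gcd≡1; gcd≡1⇒coprime)
import Data.Nat.Coprimality as Coprime
open import Data.Nat.Primality using (Prime; prime⇒irreducible; euclidsLemma; prime⇒nonZero; prime⇒nonTrivial; prime[2])
open import Data.Nat.Primality.Factorisation using (factorise; PrimeFactorisation)
open import Data.Nat.ListAction using (product)
open import Data.Nat.ListAction.Properties using (product-↭)
open import Data.Nat.Solver using (module +-*-Solver)
open import Data.Nat.Induction using (<-wellFounded)
open import Induction.WellFounded using (Acc; acc)
open import Data.List using (List; []; _∷_; map; length; upTo; cartesianProduct)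
open import Data.List.Properties using (length-map; length-++; length-upTo; map-id)
open import Data.List.Membership.Propositional using (_∈_)
open import Data.List.Membership.Propositional.Properties
open import Data.List.Membership.Propositional.Properties.WithK using (unique∧set⇒bag)
open import Data.List.Relation.Unary.Any using (here; there)
open import Data.List.Relation.Unary.All using ([]; _∷_)
import Data.List.Relation.Unary.All as All
import Data.List.Relation.Unary.All.Properties as AllProperties
open import Data.List.Relation.Unary.AllPairs using ([]; _∷_)
open import Data.List.Relation.Unary.Unique.Propositional using (Unique)
import Data.List.Relation.Unary.Unique.Propositional.Properties as Unique
open import Data.List.Relation.Binary.Permutation.Propositional using (_↭_)
open import Data.List.Relation.Binary.Permutation.Propositional.Properties using (↭-length)
open import Data.List.Relation.Binary.BagAndSetEquality using (∼bag⇒↭)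
open import Data.Product using (_×_; _,_; ∃-syntax; proj₁; proj₂; uncurry)
open import Data.Sum using (_⊎_; inj₁; inj₂)
open import Data.Empty using (⊥-elim)
open import Function.Bundles using (mk⇔)
open import Relation.Nullary using (¬_; yes; no)
open import Relation.Nullary.Decidable using (_×-dec_)
open import Relation.Binary.PropositionalEquality
open import Relation.Binary.Definitions using (tri<; tri≈; tri>)

↭-from-same-elements : ∀ {A : Set} {xs ys : List A} → Unique xs → Unique ys →
  (∀ {x} → x ∈ xs → x ∈ ys) → (∀ {x} → x ∈ ys → x ∈ xs) → xs ↭ ys
↭-from-same-elements uxs uys to from = ∼bag⇒↭ (unique∧set⇒bag uxs uys (mk⇔ to from))

Unique-map-on : ∀ {A B : Set} (f : A → B) {xs : List A} →
  (∀ {x y} → x ∈ xs → y ∈ xs → f x ≡ f y → x ≡ y) → Unique xs → Unique (map f xs)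
Unique-map-on f {[]} injective [] = []
Unique-map-on f {x ∷ xs} injective (x∉xs ∷ uxs) =
  AllProperties.map⁺ (All.tabulate λ y∈ fx≡fy →
    All.lookup x∉xs y∈ (injective (here refl) (there y∈) fx≡fy))
  ∷ Unique-map-on f (λ x∈ y∈ → injective (there x∈) (there y∈)) uxs

length-by-bijection : ∀ {A B : Set} (f : A → B) {xs : List A} {ys : List B} →
  Unique xs → Unique ys →
  (∀ {x y} → x ∈ xs → y ∈ xs → f x ≡ f y → x ≡ y) →
  (∀ {x} → x ∈ xs → f x ∈ ys) →
  (∀ {y} → y ∈ ys → ∃[ x ] (x ∈ xs × y ≡ f x)) →
  length ys ≡ length xs
length-by-bijection f {xs} {ys} uxs uys injective into onto =
  trans (↭-length (↭-from-same-elements uys (Unique-map-on f injective uxs) ys⊆image image⊆ys))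
        (length-map f xs)
  where
  ys⊆image : ∀ {y} → y ∈ ys → y ∈ map f xs
  ys⊆image y∈ with onto y∈
  ... | x , x∈ , refl = ∈-map⁺ f x∈
  image⊆ys : ∀ {y} → y ∈ map f xs → y ∈ ys
  image⊆ys y∈ with ∈-map⁻ f y∈
  ... | x , x∈ , refl = into x∈

map-involution-↭ : ∀ {A : Set} (f : A → A) {xs : List A} → Unique xs →
  (∀ {x} → x ∈ xs → f x ∈ xs) → (∀ {x} → x ∈ xs → f (f x) ≡ x) → map f xs ↭ xs
map-involution-↭ f {xs} uxs closed involutive =
  ↭-from-same-elements (Unique-map-on f injective uxs) uxs image⊆xs xs⊆image
  where
  injective : ∀ {x y} → x ∈ xs → y ∈ xs → f x ≡ f y → x ≡ y
  injective x∈ y∈ fx≡fy = trans (sym (involutive x∈)) (trans (cong f fx≡fy) (involutive y∈))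
  image⊆xs : ∀ {y} → y ∈ map f xs → y ∈ xs
  image⊆xs y∈ with ∈-map⁻ f y∈
  ... | x , x∈ , refl = closed x∈
  xs⊆image : ∀ {y} → y ∈ xs → y ∈ map f xs
  xs⊆image y∈ = subst (_∈ map f xs) (involutive y∈) (∈-map⁺ f (closed y∈))

length-cartesianProduct : ∀ {A B : Set} (xs : List A) (ys : List B) →
  length (cartesianProduct xs ys) ≡ length xs * length ys
length-cartesianProduct [] ys = refl
length-cartesianProduct (x ∷ xs) ys =
  trans (length-++ (map (x ,_) ys))
        (cong₂ _+_ (length-map (x ,_) ys) (length-cartesianProduct xs ys))

interchange : ∀ d e a b → (d * e) * (a * b) ≡ (d * a) * (e * b)
interchange = solve 4 (λ d e a b → (d :* e) :* (a :* b) := (d :* a) :* (e :* b)) refl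
  where open +-*-Solver

product-map-* : ∀ {A : Set} (f g : A → ℕ) (xs : List A) →
  product (map f xs) * product (map g xs) ≡ product (map (λ x → f x * g x) xs)
product-map-* f g [] = refl
product-map-* f g (x ∷ xs) =
  trans (interchange (f x) (product (map f xs)) (g x) (product (map g xs)))
        (cong (f x * g x *_) (product-map-* f g xs))

product-map-const : ∀ {A : Set} (f : A → ℕ) (c : ℕ) (xs : List A) →
  (∀ {x} → x ∈ xs → f x ≡ c) → product (map f xs) ≡ c ^ length xs
product-map-const f c [] constant = refl
product-map-const f c (x ∷ xs) constant =
  cong₂ _*_ (constant (here refl)) (product-map-const f c xs (λ y∈ → constant (there y∈)))

-- The cofactor m / d of a divisor d of m, defined without a proof that d ≠ 0;
-- on d = suc k it is literally the quotient used in the definition of unitaryDivisors.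
cofactor : ℕ → ℕ → ℕ
cofactor m zero = 0
cofactor m (suc k) = m / suc k

-- d·(m/d) = m; for d = 0 both sides vanish, as 0 ∣ m forces m = 0.
cofactor-spec : ∀ {m d} → d ∣ m → d * cofactor m d ≡ m
cofactor-spec {m} {zero} 0∣m = sym (0∣⇒≡0 0∣m)
cofactor-spec {m} {suc k} d∣m = m*[n/m]≡n d∣m

cofactor-unique : ∀ {m d c} → 0 < d → d * c ≡ m → cofactor m d ≡ c
cofactor-unique {d = suc k} {c} _ refl = trans (cong (_/ suc k) (*-comm (suc k) c)) (m*n/n≡m c (suc k))

cofactor-∣ : ∀ {m d} → d ∣ m → cofactor m d ∣ m
cofactor-∣ {m} {d} d∣m = divides d (sym (cofactor-spec d∣m))

divisor-pos : ∀ {m d} → 0 < m → d ∣ m → 0 < d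
divisor-pos {d = zero} 0<m 0∣m with () ← subst (0 <_) (0∣⇒≡0 0∣m) 0<m
divisor-pos {d = suc d} _ _ = z<s

cofactor-pos : ∀ {m d} → 0 < m → d ∣ m → 0 < cofactor m d
cofactor-pos 0<m d∣m = divisor-pos 0<m (cofactor-∣ d∣m)

cofactor-involutive : ∀ {m d} → 0 < m → d ∣ m → cofactor m (cofactor m d) ≡ d
cofactor-involutive {m} {d} 0<m d∣m =
  cofactor-unique (cofactor-pos 0<m d∣m) (trans (*-comm (cofactor m d) d) (cofactor-spec d∣m))

∈-divisors⁻ : ∀ {m d} → d ∈ divisors m → d ∣ m × 0 < m
∈-divisors⁻ {m} d∈ with ∈-map⁻ suc d∈
... | k , k∈ , refl with ∈-filter⁻ (λ k → suc k ∣? m) {xs = upTo m} k∈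
... | k∈upTo , k+1∣m = k+1∣m , ≤-<-trans z≤n (∈-upTo⁻ k∈upTo)

∈-divisors⁺ : ∀ {m d} → d ∣ m → 0 < m → d ∈ divisors m
∈-divisors⁺ {suc m} {zero} 0∣m _ with () ← 0∣⇒≡0 0∣m
∈-divisors⁺ {suc m} {suc k} d∣m _ =
  ∈-map⁺ suc (∈-filter⁺ (λ k → suc k ∣? suc m) (∈-upTo⁺ (∣⇒≤ d∣m)) d∣m)

∈-unitaryDivisors⁻ : ∀ {m d} → d ∈ unitaryDivisors m → d ∣ m × 0 < m × Coprime d (cofactor m d)
∈-unitaryDivisors⁻ {m} d∈ with ∈-map⁻ suc d∈
... | k , k∈ , refl with ∈-filter⁻ (λ k → (suc k ∣? m) ×-dec (gcd (suc k) (m / suc k) ≟ 1)) {xs = upTo m} k∈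
... | k∈upTo , (k+1∣m , gcd≡1) = k+1∣m , ≤-<-trans z≤n (∈-upTo⁻ k∈upTo) , gcd≡1⇒coprime gcd≡1

∈-unitaryDivisors⁺ : ∀ {m d} → d ∣ m → 0 < m → Coprime d (cofactor m d) → d ∈ unitaryDivisors m
∈-unitaryDivisors⁺ {suc m} {zero} 0∣m _ _ with () ← 0∣⇒≡0 0∣m
∈-unitaryDivisors⁺ {suc m} {suc k} d∣m _ coprime =
  ∈-map⁺ suc (∈-filter⁺ (λ k → (suc k ∣? suc m) ×-dec (gcd (suc k) (suc m / suc k) ≟ 1))
                         (∈-upTo⁺ (∣⇒≤ d∣m)) (d∣m , coprime⇒gcd≡1 coprime))

divisors-unique : ∀ m → Unique (divisors m)
divisors-unique m = Unique.map⁺ suc-injective (Unique.filter⁺ (λ k → suc k ∣? m) (Unique.upTo⁺ m))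

unitaryDivisors-unique : ∀ m → Unique (unitaryDivisors m)
unitaryDivisors-unique m = Unique.map⁺ suc-injective
  (Unique.filter⁺ (λ k → (suc k ∣? m) ×-dec (gcd (suc k) (m / suc k) ≟ 1)) (Unique.upTo⁺ m))

τ : ℕ → ℕ
τ m = length (divisors m)

τ* : ℕ → ℕ
τ* m = length (unitaryDivisors m)

-- Pairing d with m/d: a duplicate-free list of divisors of m > 0 that is closed
-- under d ↦ m/d has (∏ ds)² = m^|ds|.
product-square : ∀ {m} (ds : List ℕ) → 0 < m → Unique ds →
  (∀ {d} → d ∈ ds → d ∣ m) → (∀ {d} → d ∈ ds → cofactor m d ∈ ds) →
  product ds * product ds ≡ m ^ length ds
product-square {m} ds 0<m uds divides-m closed = begin
  product ds * product ds
    ≡⟨ cong₂ _*_ (cong product (sym (map-id ds))) (sym (product-↭ cofactors↭ds)) ⟩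
  product (map (λ d → d) ds) * product (map (cofactor m) ds)
    ≡⟨ product-map-* (λ d → d) (cofactor m) ds ⟩
  product (map (λ d → d * cofactor m d) ds)
    ≡⟨ product-map-const _ m ds (λ d∈ → cofactor-spec (divides-m d∈)) ⟩
  m ^ length ds ∎
  where
  open ≡-Reasoning
  cofactors↭ds : map (cofactor m) ds ↭ ds
  cofactors↭ds = map-involution-↭ (cofactor m) uds closed
    (λ d∈ → cofactor-involutive 0<m (divides-m d∈))

-- T(m)² = m^τ(m) and T*(m)² = m^τ*(m); for m = 0 both sides are 1.
T-square : ∀ m → T m * T m ≡ m ^ τ m
T-square zero = refl
T-square m@(suc _) = product-square (divisors m) z<s (divisors-unique m)
  (λ d∈ → proj₁ (∈-divisors⁻ d∈))
  (λ d∈ → ∈-divisors⁺ (cofactor-∣ (proj₁ (∈-divisors⁻ d∈))) z<s)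

T*-square : ∀ m → T* m * T* m ≡ m ^ τ* m
T*-square zero = refl
T*-square m@(suc _) = product-square (unitaryDivisors m) z<s (unitaryDivisors-unique m)
  (λ d∈ → proj₁ (∈-unitaryDivisors⁻ d∈)) closed
  where
  closed : ∀ {d} → d ∈ unitaryDivisors m → cofactor m d ∈ unitaryDivisors m
  closed d∈ with ∈-unitaryDivisors⁻ d∈
  ... | d∣m , _ , coprime = ∈-unitaryDivisors⁺ (cofactor-∣ d∣m) z<s
    (subst (Coprime _) (sym (cofactor-involutive z<s d∣m)) (Coprime.sym coprime))

coprime-∣ : ∀ {a b d e} → Coprime a b → d ∣ a → e ∣ b → Coprime d e
coprime-∣ coprime d∣a e∣b (i∣d , i∣e) = coprime (∣-trans i∣d d∣a , ∣-trans i∣e e∣b)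

coprime-*ˡ : ∀ {x y z} → Coprime x z → Coprime y z → Coprime (x * y) z
coprime-*ˡ x⊥z y⊥z (i∣xy , i∣z) =
  y⊥z (coprime-divisor (Coprime.sym (coprime-∣ x⊥z ∣-refl i∣z)) i∣xy , i∣z)

coprime-*ʳ : ∀ {x y z} → Coprime x y → Coprime x z → Coprime x (y * z)
coprime-*ʳ x⊥y x⊥z = Coprime.sym (coprime-*ˡ (Coprime.sym x⊥y) (Coprime.sym x⊥z))

*-pos : ∀ {d e} → 0 < d → 0 < e → 0 < d * e
*-pos {suc d} {suc e} _ _ = z<s

split-divisor : ∀ {a b x} → Coprime a b → 0 < x → x ∣ a * b →
  ∃[ d ] ∃[ e ] (d ∣ a × e ∣ b × x ≡ d * e)
split-divisor {a} {b} {x} coprime 0<x x∣ab =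
  g , x / g , gcd[m,n]∣n x a , x/g∣b , sym (m*[n/m]≡n (gcd[m,n]∣m x a))
  where
  g : ℕ
  g = gcd x a
  instance
    g≢0 : NonZero g
    g≢0 = ≢-nonZero (gcd[m,n]≢0 x a (inj₁ λ x≡0 → <-irrefl (sym x≡0) 0<x))
  x/g∣[a/g]b : x / g ∣ (a / g) * b
  x/g∣[a/g]b = *-cancelˡ-∣ g (subst₂ _∣_ (sym (m*[n/m]≡n (gcd[m,n]∣m x a)))
    (trans (cong (_* b) (sym (m*[n/m]≡n (gcd[m,n]∣n x a)))) (*-assoc g (a / g) b)) x∣ab)
  x/g∣b : x / g ∣ b
  x/g∣b = coprime-divisor (coprime-/gcd x a) x/g∣[a/g]b

split-unique : ∀ {a b d₁ d₂ e₁ e₂} → Coprime a b → d₁ ∣ a → d₂ ∣ a → e₁ ∣ b → e₂ ∣ b →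
  0 < d₁ → d₁ * e₁ ≡ d₂ * e₂ → d₁ ≡ d₂ × e₁ ≡ e₂
split-unique {d₁ = d₁} {d₂} {e₁} {e₂} coprime d₁∣a d₂∣a e₁∣b e₂∣b 0<d₁ eq = d₁≡d₂ , e₁≡e₂
  where
  d₁∣d₂ : d₁ ∣ d₂
  d₁∣d₂ = coprime-divisor (coprime-∣ coprime d₁∣a e₂∣b)
    (divides e₁ (trans (*-comm e₂ d₂) (trans (sym eq) (*-comm d₁ e₁))))
  d₂∣d₁ : d₂ ∣ d₁
  d₂∣d₁ = coprime-divisor (coprime-∣ coprime d₂∣a e₁∣b)
    (divides e₂ (trans (*-comm e₁ d₁) (trans eq (*-comm d₂ e₂))))
  d₁≡d₂ : d₁ ≡ d₂
  d₁≡d₂ = ∣-antisym d₁∣d₂ d₂∣d₁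
  e₁≡e₂ : e₁ ≡ e₂
  e₁≡e₂ = *-cancelˡ-≡ e₁ e₂ d₁ {{>-nonZero 0<d₁}} (trans eq (cong (_* e₂) (sym d₁≡d₂)))

cofactor-* : ∀ {a b d e} → 0 < d → 0 < e → d ∣ a → e ∣ b →
  cofactor (a * b) (d * e) ≡ cofactor a d * cofactor b e
cofactor-* {d = d} {e} 0<d 0<e d∣a e∣b = cofactor-unique (*-pos 0<d 0<e)
  (trans (interchange d e (cofactor _ d) (cofactor _ e)) (cong₂ _*_ (cofactor-spec d∣a) (cofactor-spec e∣b)))

-- Counting principle behind multiplicativity: if the elements of Dab are exactly the
-- products d·e with d ∈ Da, e ∈ Db, where Da, Db consist of divisors of the coprime
-- a, b (Da positive), then |Dab| = |Da|·|Db|, since such factorisations are unique.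
length-of-products : ∀ {a b} (Da Db Dab : List ℕ) → Coprime a b →
  Unique Da → Unique Db → Unique Dab →
  (∀ {d} → d ∈ Da → 0 < d × d ∣ a) → (∀ {e} → e ∈ Db → e ∣ b) →
  (∀ {d e} → d ∈ Da → e ∈ Db → d * e ∈ Dab) →
  (∀ {z} → z ∈ Dab → ∃[ d ] ∃[ e ] (d ∈ Da × e ∈ Db × z ≡ d * e)) →
  length Dab ≡ length Da * length Db
length-of-products Da Db Dab coprime uDa uDb uDab in-Da in-Db into onto =
  trans (length-by-bijection (uncurry _*_) (Unique.cartesianProduct⁺ uDa uDb) uDab
                             injective into′ onto′)
        (length-cartesianProduct Da Db)
  where
  injective : ∀ {x y} → x ∈ cartesianProduct Da Db → y ∈ cartesianProduct Da Db →
    uncurry _*_ x ≡ uncurry _*_ y → x ≡ y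
  injective {d₁ , e₁} {d₂ , e₂} x∈ y∈ eq
    with ∈-cartesianProduct⁻ Da Db x∈ | ∈-cartesianProduct⁻ Da Db y∈
  ... | d₁∈ , e₁∈ | d₂∈ , e₂∈
    with split-unique coprime (proj₂ (in-Da d₁∈)) (proj₂ (in-Da d₂∈)) (in-Db e₁∈) (in-Db e₂∈)
                      (proj₁ (in-Da d₁∈)) eq
  ... | refl , refl = refl
  into′ : ∀ {x} → x ∈ cartesianProduct Da Db → uncurry _*_ x ∈ Dab
  into′ x∈ with ∈-cartesianProduct⁻ Da Db x∈
  ... | d∈ , e∈ = into d∈ e∈
  onto′ : ∀ {z} → z ∈ Dab → ∃[ x ] (x ∈ cartesianProduct Da Db × z ≡ uncurry _*_ x)
  onto′ z∈ with onto z∈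
  ... | d , e , d∈ , e∈ , z≡de = (d , e) , ∈-cartesianProduct⁺ d∈ e∈ , z≡de

τ-multiplicative : ∀ {a b} → 0 < a → 0 < b → Coprime a b → τ (a * b) ≡ τ a * τ b
τ-multiplicative {a} {b} 0<a 0<b coprime =
  length-of-products (divisors a) (divisors b) (divisors (a * b)) coprime
    (divisors-unique a) (divisors-unique b) (divisors-unique (a * b))
    (λ d∈ → let d∣a = proj₁ (∈-divisors⁻ {a} d∈) in divisor-pos 0<a d∣a , d∣a)
    (λ e∈ → proj₁ (∈-divisors⁻ {b} e∈))
    (λ d∈ e∈ → ∈-divisors⁺ (*-pres-∣ (proj₁ (∈-divisors⁻ {a} d∈)) (proj₁ (∈-divisors⁻ {b} e∈))) 0<ab)
    onto
  where
  0<ab : 0 < a * b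
  0<ab = *-pos 0<a 0<b
  onto : ∀ {z} → z ∈ divisors (a * b) → ∃[ d ] ∃[ e ] (d ∈ divisors a × e ∈ divisors b × z ≡ d * e)
  onto z∈ with proj₁ (∈-divisors⁻ {a * b} z∈)
  ... | z∣ab with split-divisor coprime (divisor-pos 0<ab z∣ab) z∣ab
  ... | d , e , d∣a , e∣b , z≡de = d , e , ∈-divisors⁺ d∣a 0<a , ∈-divisors⁺ e∣b 0<b , z≡de

τ*-multiplicative : ∀ {a b} → 0 < a → 0 < b → Coprime a b → τ* (a * b) ≡ τ* a * τ* b
τ*-multiplicative {a} {b} 0<a 0<b coprime =
  length-of-products (unitaryDivisors a) (unitaryDivisors b) (unitaryDivisors (a * b)) coprime
    (unitaryDivisors-unique a) (unitaryDivisors-unique b) (unitaryDivisors-unique (a * b))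
    (λ d∈ → let d∣a = proj₁ (∈-unitaryDivisors⁻ {a} d∈) in divisor-pos 0<a d∣a , d∣a)
    (λ e∈ → proj₁ (∈-unitaryDivisors⁻ {b} e∈))
    into onto
  where
  0<ab : 0 < a * b
  0<ab = *-pos 0<a 0<b
  -- d·e is unitary in a·b since its cofactor is (a/d)·(b/e), coprime to d and to e.
  into : ∀ {d e} → d ∈ unitaryDivisors a → e ∈ unitaryDivisors b → d * e ∈ unitaryDivisors (a * b)
  into {d} {e} d∈ e∈ with ∈-unitaryDivisors⁻ {a} d∈ | ∈-unitaryDivisors⁻ {b} e∈
  ... | d∣a , _ , d⊥a/d | e∣b , _ , e⊥b/e =
    ∈-unitaryDivisors⁺ (*-pres-∣ d∣a e∣b) 0<ab
      (subst (Coprime _) (sym (cofactor-* 0<d 0<e d∣a e∣b))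
        (coprime-*ˡ (coprime-*ʳ d⊥a/d (coprime-∣ coprime d∣a (cofactor-∣ e∣b)))
                    (coprime-*ʳ (Coprime.sym (coprime-∣ coprime (cofactor-∣ d∣a) e∣b)) e⊥b/e)))
    where
    0<d : 0 < d
    0<d = divisor-pos 0<a d∣a
    0<e : 0 < e
    0<e = divisor-pos 0<b e∣b
  onto : ∀ {z} → z ∈ unitaryDivisors (a * b) →
    ∃[ d ] ∃[ e ] (d ∈ unitaryDivisors a × e ∈ unitaryDivisors b × z ≡ d * e)
  onto z∈ with ∈-unitaryDivisors⁻ {a * b} z∈
  ... | z∣ab , _ , z⊥ab/z with split-divisor coprime (divisor-pos 0<ab z∣ab) z∣ab
  ... | d , e , d∣a , e∣b , refl =
    d , e , ∈-unitaryDivisors⁺ d∣a 0<a (coprime-∣ de⊥ (m∣m*n e) (m∣m*n (cofactor b e)))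
          , ∈-unitaryDivisors⁺ e∣b 0<b (coprime-∣ de⊥ (n∣m*n d) (n∣m*n (cofactor a d)))
          , refl
    where
    0<d : 0 < d
    0<d = divisor-pos 0<a d∣a
    0<e : 0 < e
    0<e = divisor-pos 0<b e∣b
    de⊥ : Coprime (d * e) (cofactor a d * cofactor b e)
    de⊥ = subst (Coprime _) (cofactor-* 0<d 0<e d∣a e∣b) z⊥ab/z

prime>1 : ∀ {q} → Prime q → 1 < q
prime>1 {q} pq = nonTrivial⇒n>1 q {{prime⇒nonTrivial pq}}

prime-power-pos : ∀ {q} → Prime q → ∀ e → 0 < q ^ e
prime-power-pos {q} pq e = m^n>0 q {{prime⇒nonZero pq}} e

^-injective : ∀ {q i j} → 1 < q → q ^ i ≡ q ^ j → i ≡ j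
^-injective {q} {i} {j} 1<q eq with <-cmp i j
... | tri< i<j _ _ = ⊥-elim (<-irrefl eq (^-monoʳ-< q 1<q i<j))
... | tri≈ _ i≡j _ = i≡j
... | tri> _ _ j<i = ⊥-elim (<-irrefl (sym eq) (^-monoʳ-< q 1<q j<i))

^-split : ∀ q {i e} → i ≤ e → q ^ e ≡ q ^ i * q ^ (e ∸ i)
^-split q {i} {e} i≤e = trans (cong (q ^_) (sym (m+[n∸m]≡n i≤e))) (^-distribˡ-+-* q i (e ∸ i))

^-∣-^ : ∀ q {i e} → i ≤ e → q ^ i ∣ q ^ e
^-∣-^ q {i} {e} i≤e = divides (q ^ (e ∸ i)) (trans (^-split q i≤e) (*-comm (q ^ i) _))

prime-coprime : ∀ {q x} → Prime q → ¬ q ∣ x → Coprime q x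
prime-coprime pq q∤x (i∣q , i∣x) with prime⇒irreducible pq i∣q
... | inj₁ i≡1 = i≡1
... | inj₂ refl = ⊥-elim (q∤x i∣x)

prime-∣-prime : ∀ {q p} → Prime q → Prime p → q ∣ p → q ≡ p
prime-∣-prime pq pp q∣p with prime⇒irreducible pp q∣p
... | inj₁ q≡1 = ⊥-elim (<-irrefl (sym q≡1) (prime>1 pq))
... | inj₂ q≡p = q≡p

prime-∤-1 : ∀ {q} → Prime q → ¬ q ∣ 1
prime-∤-1 pq q∣1 = <-irrefl (sym (∣1⇒≡1 q∣1)) (prime>1 pq)

prime-power-divisor : ∀ {q x} e → Prime q → x ∣ q ^ e → ∃[ i ] (i ≤ e × x ≡ q ^ i)
prime-power-divisor zero pq x∣1 = 0 , z≤n , ∣1⇒≡1 x∣1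
prime-power-divisor {q} {x} (suc e) pq x∣qqᵉ with q ∣? x
... | yes (divides y refl) with prime-power-divisor e pq
        (*-cancelˡ-∣ q {{prime⇒nonZero pq}} (subst (_∣ q * q ^ e) (*-comm y q) x∣qqᵉ))
...   | i , i≤e , refl = suc i , s≤s i≤e , *-comm (q ^ i) q
prime-power-divisor {q} {x} (suc e) pq x∣qqᵉ | no q∤x
  with prime-power-divisor e pq (coprime-divisor (Coprime.sym (prime-coprime pq q∤x)) x∣qqᵉ)
... | i , i≤e , x≡qⁱ = i , m≤n⇒m≤1+n i≤e , x≡qⁱ

τ-prime-power : ∀ {q} e → Prime q → τ (q ^ e) ≡ suc e
τ-prime-power {q} e pq =
  trans (length-by-bijection (q ^_) (Unique.upTo⁺ (suc e)) (divisors-unique (q ^ e))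
                             (λ _ _ → ^-injective (prime>1 pq)) into onto)
        (length-upTo (suc e))
  where
  into : ∀ {i} → i ∈ upTo (suc e) → q ^ i ∈ divisors (q ^ e)
  into i∈ = ∈-divisors⁺ (^-∣-^ q (≤-pred (∈-upTo⁻ i∈))) (prime-power-pos pq e)
  onto : ∀ {x} → x ∈ divisors (q ^ e) → ∃[ i ] (i ∈ upTo (suc e) × x ≡ q ^ i)
  onto x∈ with prime-power-divisor e pq (proj₁ (∈-divisors⁻ {q ^ e} x∈))
  ... | i , i≤e , x≡qⁱ = i , ∈-upTo⁺ (s≤s i≤e) , x≡qⁱ

-- The only unitary divisors of a prime power q^e are 1 and q^e: for 0 < i < e,
-- q divides both q^i and its cofactor q^(e-i).
unitary-prime-power : ∀ {q e d} → Prime q → d ∈ unitaryDivisors (q ^ e) → d ≡ 1 ⊎ d ≡ q ^ e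
unitary-prime-power {q} {e} pq d∈ with ∈-unitaryDivisors⁻ {q ^ e} d∈
... | d∣qᵉ , _ , coprime with prime-power-divisor e pq d∣qᵉ
... | zero , _ , d≡1 = inj₁ d≡1
... | suc i , i<e , refl with e ∸ suc i in e-i
...   | zero = inj₂ (cong (q ^_) (≤-antisym i<e (m∸n≡0⇒m≤n e-i)))
...   | suc k = ⊥-elim (<-irrefl (sym (coprime (m∣m*n (q ^ i) , q∣cofactor))) (prime>1 pq))
  where
  q∣cofactor : q ∣ cofactor (q ^ e) (q ^ suc i)
  q∣cofactor = subst (q ∣_)
    (sym (trans (cofactor-unique (prime-power-pos pq (suc i)) (sym (^-split q i<e))) (cong (q ^_) e-i)))
    (m∣m*n (q ^ k))

τ*-prime-power : ∀ {q} e → Prime q → 0 < e → τ* (q ^ e) ≡ 2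
τ*-prime-power {q} e pq 0<e =
  ↭-length (↭-from-same-elements (unitaryDivisors-unique qᵉ) ((1≢qᵉ ∷ []) ∷ [] ∷ []) into onto)
  where
  qᵉ : ℕ
  qᵉ = q ^ e
  1≢qᵉ : 1 ≢ qᵉ
  1≢qᵉ 1≡qᵉ = <-irrefl 1≡qᵉ (^-monoʳ-< q (prime>1 pq) 0<e)
  into : ∀ {d} → d ∈ unitaryDivisors qᵉ → d ∈ 1 ∷ qᵉ ∷ []
  into d∈ with unitary-prime-power {e = e} pq d∈
  ... | inj₁ d≡1 = here d≡1
  ... | inj₂ d≡qᵉ = there (here d≡qᵉ)
  onto : ∀ {d} → d ∈ 1 ∷ qᵉ ∷ [] → d ∈ unitaryDivisors qᵉ
  onto (here refl) = ∈-unitaryDivisors⁺ (1∣ qᵉ) (prime-power-pos pq e)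
    (λ (i∣1 , _) → ∣1⇒≡1 i∣1)
  onto (there (here refl)) = ∈-unitaryDivisors⁺ ∣-refl (prime-power-pos pq e)
    (λ (_ , i∣1) → ∣1⇒≡1 (subst (_ ∣_) (cofactor-unique (prime-power-pos pq e) (*-identityʳ qᵉ)) i∣1))

non-multiple-pos : ∀ {q r} → ¬ q ∣ r → 0 < r
non-multiple-pos {q} {zero} q∤0 = ⊥-elim (q∤0 (q ∣0))
non-multiple-pos {r = suc r} _ = z<s

prime-∤-^ : ∀ {q r} → Prime q → ¬ q ∣ r → ∀ k → ¬ q ∣ r ^ k
prime-∤-^ pq q∤r zero = prime-∤-1 pq
prime-∤-^ {r = r} pq q∤r (suc k) q∣rrᵏ with euclidsLemma r (r ^ k) pq q∣rrᵏ
... | inj₁ q∣r = q∤r q∣r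
... | inj₂ q∣rᵏ = prime-∤-^ pq q∤r k q∣rᵏ

-- q^a is coprime to every r not divisible by the prime q: a common divisor is some
-- q^j, and j > 0 would make q divide r.
coprime-prime-power : ∀ {q r} → Prime q → ¬ q ∣ r → ∀ a → Coprime (q ^ a) r
coprime-prime-power {q} pq q∤r a (i∣qᵃ , i∣r) with prime-power-divisor a pq i∣qᵃ
... | zero , _ , i≡1 = i≡1
... | suc j , _ , refl = ⊥-elim (q∤r (∣-trans (m∣m*n (q ^ j)) i∣r))

^-distribʳ-* : ∀ x y k → (x * y) ^ k ≡ x ^ k * y ^ k
^-distribʳ-* x y zero = refl
^-distribʳ-* x y (suc k) = trans (cong (x * y *_) (^-distribʳ-* x y k)) (interchange x y (x ^ k) (y ^ k))

strip-prime : ∀ {q} → Prime q → ∀ n → 0 < n → ∃[ a ] ∃[ r ] (n ≡ q ^ a * r × ¬ q ∣ r)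
strip-prime {q} pq n = strip n (<-wellFounded n)
  where
  strip : ∀ n → Acc _<_ n → 0 < n → ∃[ a ] ∃[ r ] (n ≡ q ^ a * r × ¬ q ∣ r)
  strip n (acc smaller) 0<n with q ∣? n
  ... | no q∤n = 0 , n , sym (*-identityˡ n) , q∤n
  ... | yes (divides m refl) with strip m (smaller m<mq) 0<m
    where
    0<m : 0 < m
    0<m = >-nonZero⁻¹ m {{m*n≢0⇒m≢0 m {{>-nonZero 0<n}}}}
    m<mq : m < m * q
    m<mq = m<m*n m q {{>-nonZero 0<m}} (prime>1 pq)
  ... | a , r , m≡qᵃr , q∤r = suc a , r , mq≡qᵃ⁺¹r , q∤r
    where
    mq≡qᵃ⁺¹r : m * q ≡ q * q ^ a * r
    mq≡qᵃ⁺¹r = trans (cong (_* q) m≡qᵃr) (trans (*-comm (q ^ a * r) q) (sym (*-assoc q (q ^ a) r)))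

record PrimePowerSplit (n : ℕ) : Set where
  constructor prime-power-split
  field
    q a r : ℕ
    q-prime : Prime q
    a-pos : 0 < a
    q∤r : ¬ q ∣ r
    n≡qᵃr : n ≡ q ^ a * r

split-prime-power : ∀ {n} → 1 < n → PrimePowerSplit n
split-prime-power {n} 1<n = from (factorise n {{>-nonZero (<-trans z<s 1<n)}})
  where
  from : PrimeFactorisation n → PrimePowerSplit n
  from record { factors = [] ; isFactorisation = n≡1 } = ⊥-elim (<-irrefl (sym n≡1) 1<n)
  from record { factors = q ∷ qs ; isFactorisation = n≡qΠ ; factorsPrime = pq ∷ _ }
    with strip-prime pq n (<-trans z<s 1<n)
  ... | zero , r , n≡r , q∤r = ⊥-elim (q∤r (subst (q ∣_) (trans n≡r (*-identityˡ r)) q∣n))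
    where
    q∣n : q ∣ n
    q∣n = divides (product qs) (trans n≡qΠ (*-comm q (product qs)))
  ... | suc a , r , n≡qᵃr , q∤r = prime-power-split q (suc a) r pq z<s q∤r n≡qᵃr

τ*-split : ∀ {q a r} → Prime q → 0 < a → ¬ q ∣ r → τ* (q ^ a * r) ≡ 2 * τ* r
τ*-split {q} {a} {r} pq 0<a q∤r =
  trans (τ*-multiplicative (prime-power-pos pq a) (non-multiple-pos q∤r) (coprime-prime-power pq q∤r a))
        (cong (_* τ* r) (τ*-prime-power a pq 0<a))

τ-split-power : ∀ {q a r} → Prime q → ¬ q ∣ r → ∀ k → τ ((q ^ a * r) ^ k) ≡ suc (a * k) * τ (r ^ k)
τ-split-power {q} {a} {r} pq q∤r k = begin
  τ ((q ^ a * r) ^ k)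
    ≡⟨ cong τ (trans (^-distribʳ-* (q ^ a) r k) (cong (_* r ^ k) (^-*-assoc q a k))) ⟩
  τ (q ^ (a * k) * r ^ k)
    ≡⟨ τ-multiplicative (prime-power-pos pq (a * k)) (non-multiple-pos q∤rᵏ)
                        (coprime-prime-power pq q∤rᵏ (a * k)) ⟩
  τ (q ^ (a * k)) * τ (r ^ k)
    ≡⟨ cong (_* τ (r ^ k)) (τ-prime-power (a * k) pq) ⟩
  suc (a * k) * τ (r ^ k) ∎
  where
  open ≡-Reasoning
  q∤rᵏ : ¬ q ∣ r ^ k
  q∤rᵏ = prime-∤-^ pq q∤r k

double : ∀ k → 2 * k ≡ k + k
double k = cong (k +_) (+-identityʳ k)

square-injective : ∀ {x y} → x * x ≡ y * y → x ≡ y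
square-injective {x} {y} xx≡yy with <-cmp x y
... | tri< x<y _ _ = ⊥-elim (<-irrefl xx≡yy (*-mono-< x<y x<y))
... | tri≈ _ x≡y _ = x≡y
... | tri> _ _ y<x = ⊥-elim (<-irrefl (sym xx≡yy) (*-mono-< y<x y<x))

T∘T*-square : ∀ {n w} → τ* n ≡ 2 * w → T (T* n) * T (T* n) ≡ n ^ (w * τ (n ^ w))
T∘T*-square {n} {w} τ*≡2w = begin
  T (T* n) * T (T* n)  ≡⟨ T-square (T* n) ⟩
  T* n ^ τ (T* n)      ≡⟨ cong (λ m → m ^ τ m) T*≡nʷ ⟩
  (n ^ w) ^ τ (n ^ w)  ≡⟨ ^-*-assoc n w (τ (n ^ w)) ⟩
  n ^ (w * τ (n ^ w))  ∎
  where
  open ≡-Reasoning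
  T*≡nʷ : T* n ≡ n ^ w
  T*≡nʷ = square-injective (begin
    T* n * T* n    ≡⟨ T*-square n ⟩
    n ^ τ* n       ≡⟨ cong (n ^_) (trans τ*≡2w (double w)) ⟩
    n ^ (w + w)    ≡⟨ ^-distribˡ-+-* n w w ⟩
    n ^ w * n ^ w  ∎)

perfect⇒criterion : ∀ {n w K} → 1 < n → τ* n ≡ 2 * w → KPerfect K n → w * τ (n ^ w) ≡ 2 * K
perfect⇒criterion {n} {w} {K} 1<n τ*≡2w perfect = ^-injective 1<n (begin
  n ^ (w * τ (n ^ w))  ≡⟨ T∘T*-square {n} {w} τ*≡2w ⟨
  T (T* n) * T (T* n)  ≡⟨ cong₂ _*_ perfect perfect ⟩
  n ^ K * n ^ K        ≡⟨ ^-distribˡ-+-* n K K ⟨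
  n ^ (K + K)          ≡⟨ cong (n ^_) (double K) ⟨
  n ^ (2 * K)          ∎)
  where open ≡-Reasoning

criterion⇒perfect : ∀ {n w K} → τ* n ≡ 2 * w → w * τ (n ^ w) ≡ 2 * K → KPerfect K n
criterion⇒perfect {n} {w} {K} τ*≡2w criterion = square-injective (begin
  T (T* n) * T (T* n)  ≡⟨ T∘T*-square {n} {w} τ*≡2w ⟩
  n ^ (w * τ (n ^ w))  ≡⟨ cong (n ^_) (trans criterion (double K)) ⟩
  n ^ (K + K)          ≡⟨ ^-distribˡ-+-* n K K ⟩
  n ^ K * n ^ K        ∎)
  where open ≡-Reasoning

odd-form : ∀ p → ¬ 2 ∣ p → ∃[ h ] (p ≡ suc (h * 2))
odd-form p 2∤p with p % 2 in p%2 | m%n<n p 2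
... | 0 | _ = ⊥-elim (2∤p (m%n≡0⇒n∣m p 2 p%2))
... | 1 | _ = p / 2 , trans (m≡m%n+[m/n]*n p 2) (cong (_+ p / 2 * 2) p%2)
... | suc (suc _) | s≤s (s≤s ())

odd-not-even : ∀ h → ¬ 2 ∣ suc (h * 2)
odd-not-even h 2∣2h+1 with ∣1⇒≡1 (∣m+n∣m⇒∣n (subst (2 ∣_) (+-comm 1 (h * 2)) 2∣2h+1) (n∣m*n h))
... | ()

half-pos : ∀ h → 1 < suc (h * 2) → 0 < h
half-pos zero (s≤s ())
half-pos (suc h) _ = z<s

-- Part (1): n = p₁^(2p²−1) has τ*(n) = 2 and τ(n) = 2p².
prime-power-perfect : ∀ p p₁ → Prime p → Prime p₁ → KPerfect (p ^ 2) (p₁ ^ (2 * p ^ 2 ∸ 1))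
prime-power-perfect p p₁ pp pp₁ = criterion⇒perfect {p₁ ^ A} {1} {p ^ 2} (τ*-prime-power A pp₁ 0<A) criterion
  where
  open ≡-Reasoning
  A : ℕ
  A = 2 * p ^ 2 ∸ 1
  2≤2p² : 2 ≤ 2 * p ^ 2
  2≤2p² = *-monoʳ-≤ 2 (prime-power-pos pp 2)
  0<A : 0 < A
  0<A = ∸-monoˡ-≤ 1 2≤2p²
  criterion : 1 * τ ((p₁ ^ A) ^ 1) ≡ 2 * p ^ 2
  criterion = begin
    1 * τ ((p₁ ^ A) ^ 1)  ≡⟨ *-identityˡ _ ⟩
    τ ((p₁ ^ A) ^ 1)      ≡⟨ cong τ (*-identityʳ (p₁ ^ A)) ⟩
    τ (p₁ ^ A)            ≡⟨ τ-prime-power A pp₁ ⟩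
    1 + A                 ≡⟨ +-comm 1 A ⟩
    A + 1                 ≡⟨ m∸n+n≡m (<-trans z<s 2≤2p²) ⟩
    2 * p ^ 2             ∎

-- Part (2) for the odd prime P = 2h + 1: n = p₁^h·p₂^h has τ*(n) = 4 and τ(n²) = P².
two-prime-perfect-2h+1 : ∀ h p₁ p₂ → Prime (suc (h * 2)) → Prime p₁ → Prime p₂ → p₁ ≢ p₂ →
  KPerfect (suc (h * 2) ^ 2) (p₁ ^ h * p₂ ^ h)
two-prime-perfect-2h+1 h p₁ p₂ pP pp₁ pp₂ p₁≢p₂ = criterion⇒perfect {p₁ ^ h * p₂ ^ h} {2} {P ^ 2} τ*≡4 criterion
  where
  open ≡-Reasoning
  P : ℕ
  P = suc (h * 2)
  0<h : 0 < h
  0<h = half-pos h (prime>1 pP)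
  p₁∤p₂ʰ : ¬ p₁ ∣ p₂ ^ h
  p₁∤p₂ʰ = prime-∤-^ pp₁ (λ p₁∣p₂ → p₁≢p₂ (prime-∣-prime pp₁ pp₂ p₁∣p₂)) h
  τ*≡4 : τ* (p₁ ^ h * p₂ ^ h) ≡ 2 * 2
  τ*≡4 = trans (τ*-split pp₁ 0<h p₁∤p₂ʰ) (cong (2 *_) (τ*-prime-power h pp₂ 0<h))
  criterion : 2 * τ ((p₁ ^ h * p₂ ^ h) ^ 2) ≡ 2 * P ^ 2
  criterion = cong (2 *_) (begin
    τ ((p₁ ^ h * p₂ ^ h) ^ 2)  ≡⟨ τ-split-power {a = h} pp₁ p₁∤p₂ʰ 2 ⟩
    P * τ ((p₂ ^ h) ^ 2)       ≡⟨ cong (λ m → P * τ m) (^-*-assoc p₂ h 2) ⟩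
    P * τ (p₂ ^ (h * 2))       ≡⟨ cong (P *_) (τ-prime-power (h * 2) pp₂) ⟩
    P * P                      ≡⟨ cong (P *_) (*-identityʳ P) ⟨
    P ^ 2                      ∎)

two-prime-perfect : ∀ p p₁ p₂ → Prime p → ¬ 2 ∣ p → Prime p₁ → Prime p₂ → p₁ ≢ p₂ →
  KPerfect (p ^ 2) (p₁ ^ ((p ∸ 1) / 2) * p₂ ^ ((p ∸ 1) / 2))
two-prime-perfect p p₁ p₂ pp 2∤p pp₁ pp₂ p₁≢p₂ with odd-form p 2∤p
... | h , refl = subst (λ k → KPerfect (suc (h * 2) ^ 2) (p₁ ^ k * p₂ ^ k))
                       (sym (m*n/n≡m h 2)) (two-prime-perfect-2h+1 h p₁ p₂ pp pp₁ pp₂ p₁≢p₂)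

-- If p ∣ u and u·v = p² with v > 1 for a prime p, then u = v = p: writing
-- u = u′p gives u′v = p, so v is a divisor of p other than 1.
prime-square-factor : ∀ {u v p} → Prime p → 1 < v → p ∣ u → u * v ≡ p * p → u ≡ p × v ≡ p
prime-square-factor {u} {v} {p} pp 1<v (divides u′ u≡u′p) uv≡pp = u≡p , v≡p
  where
  instance _ = prime⇒nonZero pp
  u′v≡p : u′ * v ≡ p
  u′v≡p = *-cancelˡ-≡ (u′ * v) p p (begin
    p * (u′ * v)  ≡⟨ *-assoc p u′ v ⟨
    p * u′ * v    ≡⟨ cong (_* v) (trans (*-comm p u′) (sym u≡u′p)) ⟩
    u * v         ≡⟨ uv≡pp ⟩
    p * p         ∎)
    where open ≡-Reasoning
  v≡p : v ≡ p
  v≡p with prime⇒irreducible pp (divides u′ (sym u′v≡p))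
  ... | inj₁ v≡1 = ⊥-elim (<-irrefl (sym v≡1) 1<v)
  ... | inj₂ v≡p = v≡p
  u≡p : u ≡ p
  u≡p = *-cancelʳ-≡ u p p (trans (cong (u *_) (sym v≡p)) uv≡pp)

prime-square-factors : ∀ {x y p} → Prime p → 1 < x → 1 < y → x * y ≡ p * p → x ≡ p × y ≡ p
prime-square-factors {x} {y} {p} pp 1<x 1<y xy≡pp with euclidsLemma x y pp (divides p xy≡pp)
... | inj₁ p∣x = prime-square-factor pp 1<y p∣x xy≡pp
... | inj₂ p∣y with prime-square-factor pp 1<x p∣y (trans (*-comm y x) xy≡pp)
...   | y≡p , x≡p = x≡p , y≡p

-- v·((4v)a + 1)·t = 2 has no solution with a > 0, as the middle factor is at least 5.
no-small-product : ∀ v a t → 0 < a → v * (suc (a * (2 * (2 * v))) * t) ≢ 2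
no-small-product zero a t _ ()
no-small-product (suc v) a zero _ eq =
  0≢2 (trans (sym (trans (cong (suc v *_) (*-zeroʳ (suc (a * w)))) (*-zeroʳ (suc v)))) eq)
  where
  w : ℕ
  w = 2 * (2 * suc v)
  0≢2 : 0 ≢ 2
  0≢2 ()
no-small-product (suc v) a (suc t) 0<a eq = <⇒≱ (≤-trans (s≤s (s≤s (s≤s z≤n))) 5≤X) X≤2
  where
  w : ℕ
  w = 2 * (2 * suc v)
  X : ℕ
  X = suc (a * w) * suc t
  X≤2 : X ≤ 2
  X≤2 = ∣⇒≤ (divides (suc v) (sym eq))
  5≤X : 5 ≤ X
  5≤X = ≤-trans (s≤s (≤-trans (*-monoʳ-≤ 2 (*-monoʳ-≤ 2 (s≤s (z≤n {v})))) (m≤n*m w a {{>-nonZero 0<a}})))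
                (m≤m*n (suc (a * w)) (suc t))

-- With three or more prime factors the criterion reads 4v·(4va + 1)·t = 2p²; this
-- forces p² even, hence p = 2, and then v·(4va + 1)·t = 2, which is impossible.
no-three-factor-solution : ∀ {p} v a t → 0 < a → Prime p →
  2 * (2 * v) * (suc (a * (2 * (2 * v))) * t) ≢ 2 * p ^ 2
no-three-factor-solution {p} v a t 0<a pp eq = no-small-product v a t 0<a vX≡2
  where
  X : ℕ
  X = suc (a * (2 * (2 * v))) * t
  2vX≡p² : 2 * v * X ≡ p ^ 2
  2vX≡p² = *-cancelˡ-≡ _ _ 2 (trans (sym (*-assoc 2 (2 * v) X)) eq)
  p≡2 : p ≡ 2
  p≡2 with 2 ∣? p
  ... | yes 2∣p = sym (prime-∣-prime prime[2] pp 2∣p)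
  ... | no 2∤p = ⊥-elim (prime-∤-^ prime[2] 2∤p 2 (subst (2 ∣_) 2vX≡p² (∣m⇒∣m*n X (m∣m*n v))))
  vX≡2 : v * X ≡ 2
  vX≡2 = *-cancelˡ-≡ _ _ 2 (trans (sym (*-assoc 2 v X)) (trans 2vX≡p² (cong (_^ 2) p≡2)))

PrimePowerShape : ℕ → ℕ → Set
PrimePowerShape p n = ∃[ p₁ ] (Prime p₁ × n ≡ p₁ ^ (2 * p ^ 2 ∸ 1))

TwoPrimeShape : ℕ → ℕ → Set
TwoPrimeShape p n = ¬ (2 ∣ p) × ∃[ p₁ ] ∃[ p₂ ] (Prime p₁ × Prime p₂ × p₁ ≢ p₂ ×
  n ≡ p₁ ^ ((p ∸ 1) / 2) * p₂ ^ ((p ∸ 1) / 2))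

-- One prime factor, n = q^a: the criterion with w = 1 reads a + 1 = 2p².
one-prime-case : ∀ {p q a} → Prime q → 0 < a → 1 < q ^ a * 1 →
  KPerfect (p ^ 2) (q ^ a * 1) → PrimePowerShape p (q ^ a * 1)
one-prime-case {p} {q} {a} pq 0<a 1<n perfect =
  q , pq , trans (*-identityʳ (q ^ a)) (cong (λ k → q ^ (k ∸ 1)) a+1≡2p²)
  where
  open ≡-Reasoning
  n : ℕ
  n = q ^ a * 1
  q∤1 : ¬ q ∣ 1
  q∤1 = prime-∤-1 pq
  criterion : 1 * τ (n ^ 1) ≡ 2 * p ^ 2
  criterion = perfect⇒criterion {n} {1} {p ^ 2} 1<n (τ*-split pq 0<a q∤1) perfect
  a+1≡2p² : suc a ≡ 2 * p ^ 2
  a+1≡2p² = begin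
    suc a                    ≡⟨ cong suc (*-identityʳ a) ⟨
    suc (a * 1)              ≡⟨ *-identityʳ _ ⟨
    suc (a * 1) * τ (1 ^ 1)  ≡⟨ τ-split-power {a = a} pq q∤1 1 ⟨
    τ (n ^ 1)                ≡⟨ *-identityˡ _ ⟨
    1 * τ (n ^ 1)            ≡⟨ criterion ⟩
    2 * p ^ 2                ∎

-- Two prime factors, n = q^a·q′^b: the criterion with w = 2 reads
-- 2(2a + 1)(2b + 1) = 2p², so 2a + 1 = 2b + 1 = p.
two-prime-case : ∀ {p q q′ a b} → Prime p → Prime q → Prime q′ → 0 < a → 0 < b →
  ¬ q ∣ q′ ^ b * 1 → 1 < q ^ a * (q′ ^ b * 1) →
  KPerfect (p ^ 2) (q ^ a * (q′ ^ b * 1)) → TwoPrimeShape p (q ^ a * (q′ ^ b * 1))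
two-prime-case {p} {q} {q′} {a} {b} pp pq pq′ 0<a 0<b q∤r 1<n perfect =
  subst (λ m → ¬ 2 ∣ m) 2a+1≡p (odd-not-even a) , q , q′ , pq , pq′ , q≢q′ , n≡shape
  where
  open ≡-Reasoning
  r : ℕ
  r = q′ ^ b * 1
  n : ℕ
  n = q ^ a * r
  q′∤1 : ¬ q′ ∣ 1
  q′∤1 = prime-∤-1 pq′
  criterion : 2 * τ (n ^ 2) ≡ 2 * p ^ 2
  criterion = perfect⇒criterion {n} {2} {p ^ 2} 1<n
    (trans (τ*-split pq 0<a q∤r) (cong (2 *_) (τ*-split pq′ 0<b q′∤1))) perfect
  product≡p² : suc (a * 2) * suc (b * 2) ≡ p * p
  product≡p² = begin
    suc (a * 2) * suc (b * 2)                ≡⟨ cong (suc (a * 2) *_) (*-identityʳ _) ⟨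
    suc (a * 2) * (suc (b * 2) * τ (1 ^ 2))  ≡⟨ cong (suc (a * 2) *_) (τ-split-power {a = b} pq′ q′∤1 2) ⟨
    suc (a * 2) * τ (r ^ 2)                  ≡⟨ τ-split-power {a = a} pq q∤r 2 ⟨
    τ (n ^ 2)                                ≡⟨ *-cancelˡ-≡ _ _ 2 criterion ⟩
    p * (p * 1)                              ≡⟨ cong (p *_) (*-identityʳ p) ⟩
    p * p                                    ∎
  odd>1 : ∀ k → 0 < k → 1 < suc (k * 2)
  odd>1 (suc k) _ = s≤s z<s
  factors≡p : suc (a * 2) ≡ p × suc (b * 2) ≡ p
  factors≡p = prime-square-factors {suc (a * 2)} {suc (b * 2)} pp (odd>1 a 0<a) (odd>1 b 0<b) product≡p²
  2a+1≡p : suc (a * 2) ≡ p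
  2a+1≡p = proj₁ factors≡p
  half≡ : ∀ {k} → suc (k * 2) ≡ p → (p ∸ 1) / 2 ≡ k
  half≡ {k} 2k+1≡p = trans (cong (λ m → (m ∸ 1) / 2) (sym 2k+1≡p)) (m*n/n≡m k 2)
  n≡shape : n ≡ q ^ ((p ∸ 1) / 2) * q′ ^ ((p ∸ 1) / 2)
  n≡shape = trans (cong (q ^ a *_) (*-identityʳ (q′ ^ b)))
    (sym (cong₂ (λ i j → q ^ i * q′ ^ j) (half≡ {a} 2a+1≡p) (half≡ {b} (proj₂ factors≡p))))
  q≢q′ : q ≢ q′
  q≢q′ refl = q∤r (∣m⇒∣m*n 1 (∣-trans (m∣m*n 1) (^-∣-^ q {1} 0<b)))

-- Three or more prime factors, n = q^a·r with τ*(r) = 4v: the criterion with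
-- w = 4v would give 4v·(4va + 1)·τ(r^w) = 2p².
many-prime-case : ∀ {p q a r} v → Prime p → Prime q → 0 < a → ¬ q ∣ r →
  τ* r ≡ 2 * (2 * v) → 1 < q ^ a * r → ¬ KPerfect (p ^ 2) (q ^ a * r)
many-prime-case {p} {q} {a} {r} v pp pq 0<a q∤r τ*r≡4v 1<n perfect =
  no-three-factor-solution v a (τ (r ^ w)) 0<a pp
    (trans (cong (w *_) (sym (τ-split-power {a = a} pq q∤r w))) criterion)
  where
  w : ℕ
  w = 2 * (2 * v)
  criterion : w * τ ((q ^ a * r) ^ w) ≡ 2 * p ^ 2
  criterion = perfect⇒criterion {q ^ a * r} {w} {p ^ 2} 1<n
    (trans (τ*-split pq 0<a q∤r) (cong (2 *_) τ*r≡4v)) perfect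

one-or-more : ∀ {r} → 0 < r → r ≡ 1 ⊎ 1 < r
one-or-more {suc zero} _ = inj₁ refl
one-or-more {suc (suc r)} _ = inj₂ (s≤s z<s)

-- Part (3), stated positively: every p²-perfect n > 1 has one of the two shapes.
-- Split off prime powers until the remaining cofactor is 1 or a third prime appears.
perfect⇒shape : ∀ p n → Prime p → 1 < n → KPerfect (p ^ 2) n →
  PrimePowerShape p n ⊎ TwoPrimeShape p n
perfect⇒shape p n pp 1<n perfect with split-prime-power 1<n
... | prime-power-split q a r pq 0<a q∤r refl with one-or-more (non-multiple-pos q∤r)
...   | inj₁ refl = inj₁ (one-prime-case {p} pq 0<a 1<n perfect)
...   | inj₂ 1<r with split-prime-power 1<r
...     | prime-power-split q′ b r′ pq′ 0<b q′∤r′ refl with one-or-more (non-multiple-pos q′∤r′)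
...       | inj₁ refl = inj₂ (two-prime-case pp pq pq′ 0<a 0<b q∤r 1<n perfect)
...       | inj₂ 1<r′ with split-prime-power 1<r′
...         | prime-power-split q″ c r″ pq″ 0<c q″∤r″ refl =
  ⊥-elim (many-prime-case (τ* r″) pp pq 0<a q∤r τ*r≡4v 1<n perfect)
  where
  τ*r≡4v : τ* (q′ ^ b * (q″ ^ c * r″)) ≡ 2 * (2 * τ* r″)
  τ*r≡4v = trans (τ*-split pq′ 0<b q′∤r′) (cong (2 *_) (τ*-split {a = c} pq″ 0<c q″∤r″))

corollary3p5 : ((p p₁ : ℕ) → Prime p → Prime p₁ →
    KPerfect (p ^ 2) (p₁ ^ (2 * p ^ 2 ∸ 1)))
    × ((p p₁ p₂ : ℕ) → Prime p → ¬ (2 ∣ p) → Prime p₁ → Prime p₂ → p₁ ≢ p₂ →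
    KPerfect (p ^ 2) (p₁ ^ ((p ∸ 1) / 2) * p₂ ^ ((p ∸ 1) / 2)))
    × ((p n : ℕ) → Prime p → 1 < n →
    ¬ (∃[ p₁ ] (Prime p₁ × n ≡ p₁ ^ (2 * p ^ 2 ∸ 1))) →
    ¬ (¬ (2 ∣ p) × ∃[ p₁ ] ∃[ p₂ ] (Prime p₁ × Prime p₂ × p₁ ≢ p₂ ×
    n ≡ p₁ ^ ((p ∸ 1) / 2) * p₂ ^ ((p ∸ 1) / 2))) →
    ¬ KPerfect (p ^ 2) n)
corollary3p5 = prime-power-perfect , two-prime-perfect , not-perfect
  where
  not-perfect : ∀ p n → Prime p → 1 < n → ¬ PrimePowerShape p n → ¬ TwoPrimeShape p n →
    ¬ KPerfect (p ^ 2) n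
  not-perfect p n pp 1<n ¬shape₁ ¬shape₂ perfect with perfect⇒shape p n pp 1<n perfect
  ... | inj₁ shape₁ = ¬shape₁ shape₁
  ... | inj₂ shape₂ = ¬shape₂ shape₂
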